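{- Let $c > 1/4$ be a constant. If $G$ is a minimal counterexample to the inequality $\alpha_{1}(G) + \tau_{B}(G) \le c\, n(G)^2$, then $\omega(G) < \frac{1}{4c-1}$.
   Context: All graphs are finite, simple and undirected; $n(G)$ is the number of vertices of $G$ and $\omega(G)$ is its clique number. A triangle-independent set in $G$ is a set of edges containing at most one edge from each triangle of $G$; $\alpha_{1}(G)$ denotes the maximum size of a triangle-independent set in $G$. $\tau_{B}(G)$ denotes the minimum size of a set of edges whose deletion from $G$ leaves a bipartite graph. A minimal counterexample to the inequality $\alpha_{1}(H) + \tau_{B}(H) \le c\, n(H)^2$ is a graph $G$ which violates the inequality while every proper induced subgraph $H$ of $G$ satisfies it.
   Formalization: The constant c ranges over the rationals greater than 1/4. -}

module Defs where

open import Data.Nat as ℕ using (ℕ; zero; suc)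
open import Data.Bool using (Bool; true; false; if_then_else_; _∧_)
open import Data.Fin using (Fin; toℕ)
open import Data.Fin.Properties using ()
open import Data.List using (List; map; length)
open import Data.Nat.ListAction using (sum)
open import Data.List using (allFin)
open import Data.Product using (Σ; _×_; ∃; ∃-syntax; _,_)
open import Relation.Binary.PropositionalEquality using (_≡_; _≢_)
open import Relation.Nullary using (¬_)
open import Relation.Nullary.Decidable using (⌊_⌋)
open import Function.Definitions using (Injective)
open import Data.Rational as ℚ using (ℚ; _/_)
open import Data.Integer using (+_)

record Graph (n : ℕ) : Set where
  field
    adj   : Fin n → Fin n → Bool
    sym   : ∀ x y → adj x y ≡ adj y x
    irref : ∀ x → adj x x ≡ false
open Graph public

nV : ∀ {n} → Graph n → ℕ
nV {n} _ = n

-- Induced subgraph of G on the image of an injective map f : Fin m → Fin n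
-- (every induced subgraph on m vertices is of this form, up to isomorphism).
induced : ∀ {m n} → Graph n → (f : Fin m → Fin n) → Injective _≡_ _≡_ f → Graph m
induced G f inj = record
  { adj   = λ x y → adj G (f x) (f y)
  ; sym   = λ x y → sym G (f x) (f y)
  ; irref = λ x → irref G (f x) }

record EdgeSet {n} (G : Graph n) : Set where
  field
    mem    : Fin n → Fin n → Bool
    memSym : ∀ x y → mem x y ≡ mem y x
    ⊆E     : ∀ x y → mem x y ≡ true → adj G x y ≡ true
open EdgeSet public

b2n : Bool → ℕ
b2n true  = 1
b2n false = 0

size : ∀ {n} {G : Graph n} → EdgeSet G → ℕ
size {n} F = sum (map (λ x → sum (map (λ y →
  b2n (⌊ toℕ x ℕ.<? toℕ y ⌋ ∧ mem F x y)) (allFin n))) (allFin n))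

TriangleIndependent : ∀ {n} {G : Graph n} → EdgeSet G → Set
TriangleIndependent {n} {G} F = ∀ x y z →
  adj G x y ≡ true → adj G y z ≡ true → adj G x z ≡ true →
  b2n (mem F x y) ℕ.+ b2n (mem F y z) ℕ.+ b2n (mem F x z) ℕ.≤ 1

IsAlpha1 : ∀ {n} → Graph n → ℕ → Set
IsAlpha1 G a =
  (Σ (EdgeSet G) λ F → TriangleIndependent F × size F ≡ a) ×
  (∀ (F : EdgeSet G) → TriangleIndependent F → size F ℕ.≤ a)

BipartiteAfterDeleting : ∀ {n} (G : Graph n) → EdgeSet G → Set
BipartiteAfterDeleting {n} G F = Σ (Fin n → Bool) λ col → (∀ (x y : Fin n) →
  adj G x y ≡ true → mem F x y ≡ false → col x ≢ col y)

IsTauB : ∀ {n} → Graph n → ℕ → Set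
IsTauB G t =
  (Σ (EdgeSet G) λ F → BipartiteAfterDeleting G F × size F ≡ t) ×
  (∀ (F : EdgeSet G) → BipartiteAfterDeleting G F → t ℕ.≤ size F)

IsClique : ∀ {n k} → Graph n → (Fin k → Fin n) → Set
IsClique G f = Injective _≡_ _≡_ f × (∀ i j → i ≢ j → adj G (f i) (f j) ≡ true)

IsOmega : ∀ {n} → Graph n → ℕ → Set
IsOmega G w = (Σ (Fin w → _) λ f → IsClique G f) ×
  (∀ k (f : Fin k → _) → IsClique G f → k ℕ.≤ w)

ℕ→ℚ : ℕ → ℚ
ℕ→ℚ k = + k / 1

Satisfies : ℚ → ∀ {n} → Graph n → Set
Satisfies c {n} G = ∀ a t → IsAlpha1 G a → IsTauB G t →
  ℕ→ℚ (a ℕ.+ t) ℚ.≤ c ℚ.* ℕ→ℚ (n ℕ.* n)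

MinimalCounterexample : ℚ → ∀ {n} → Graph n → Set
MinimalCounterexample c {n} G =
  ¬ Satisfies c G ×
  (∀ m (f : Fin m → Fin n) (inj : Injective _≡_ _≡_ f) → m ℕ.< n → Satisfies c (induced G f inj))

module Submission where

-- Let c > 1/4 and let G be a minimal counterexample to α₁ + τ_B ≤ c n², with a maximum
-- clique K of size w ≥ 1.  The induced subgraph H = G − K on the other m = n − w vertices
-- satisfies α₁(H) + τ_B(H) ≤ c m², and two counting estimates transfer this to G.
--   α₁: a triangle-independent set of G meets each vertex of H in at most one edge into K
--       (two such edges lie in a triangle), so α₁(G) ≤ α₁(H) + m + w/2.
--   τ_B: extend an optimal 2-colouring of H − D to G by colouring K alternately, in one of
--       two ways.  Each H–K edge is monochromatic in exactly one of them, and by maximality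
--       of K each vertex of H has at most w − 1 neighbours in K, so the better colouring
--       gives τ_B(G) ≤ τ_B(H) + m(w − 1)/2 + (w² − w)/4.
-- Adding, 4(α₁ + τ_B)(G) ≤ 4c m² + 2m(w + 1) + w(w + 1) ≤ 4c (m + w)² once w + 1 ≤ 4cw,
-- i.e. once w ≥ 1/(4c − 1); so a minimal counterexample has ω(G) < 1/(4c − 1).

open import Defs renaming (sym to adj-sym)
open import Data.Nat using (ℕ)

module Counting where

  open import Data.Nat using (zero; suc; _+_; _*_; _≤_; z≤n; s≤s)
  open import Data.Nat.Properties hiding (_≟_)
  import Data.Bool as Bool
  open import Data.Bool using (Bool; true; false; _∧_; not; _xor_; if_then_else_)
  open import Data.Bool.Properties using (not-involutive; xor-annihilates-not; xor-comm; xor-same; ¬-not)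
  open import Data.Fin using (Fin; toℕ; _≟_)
  open import Data.Fin.Properties using (any?; all?; ¬∀⟶∃¬; toℕ-injective)
    renaming (suc-injective to fsuc-injective; 0≢1+n to 0F≢suc)
  open import Data.List using (map; tabulate; allFin)
  import Data.Nat.ListAction as List
  open import Data.Product using (Σ; ∃; _×_; _,_; proj₁; proj₂; map₂) renaming (map to map-×)
  open import Data.Empty using (⊥-elim)
  open import Function using (_∘_)
  open import Data.Vec.Functional using (_∷_)
  open import Data.Nat.Solver using (module +-*-Solver)
  open import Function.Definitions using (Injective)
  open import Relation.Binary.PropositionalEquality
  open import Relation.Nullary using (¬_; yes; no; does)
  open import Relation.Nullary.Decidable using (⌊_⌋; ¬¬-excluded-middle)
  open import Algebra.Properties.CommutativeMonoid.Sum +-0-commutativeMonoid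
    using (sum-syntax; sum-cong-≗; ∑-distrib-+; ∑-comm; sum-replicate-zero)

  ∑-const : ∀ n k → ∑[ i < n ] k ≡ n * k
  ∑-const zero    k = refl
  ∑-const (suc n) k = cong (k +_) (∑-const n k)

  ∑-mono : ∀ {n} {f g : Fin n → ℕ} → (∀ i → f i ≤ g i) → ∑[ i < n ] f i ≤ ∑[ i < n ] g i
  ∑-mono {zero}  f≤g = z≤n
  ∑-mono {suc n} f≤g = +-mono-≤ (f≤g Fin.zero) (∑-mono (f≤g ∘ Fin.suc))

  b2n≤1 : ∀ b → b2n b ≤ 1
  b2n≤1 true  = s≤s z≤n
  b2n≤1 false = z≤n

  count≤ : ∀ {n} (h : Fin n → Bool) → ∑[ i < n ] b2n (h i) ≤ n
  count≤ {n} h = ≤-trans (∑-mono (b2n≤1 ∘ h)) (≤-reflexive (trans (∑-const n 1) (*-identityʳ n)))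

  count-missing : ∀ {n} (h : Fin n → Bool) j → h j ≡ false → ∑[ i < n ] b2n (h i) + 1 ≤ n
  count-missing {suc n} h Fin.zero hj≡false rewrite hj≡false =
    ≤-trans (≤-reflexive (+-comm _ 1)) (s≤s (count≤ (h ∘ Fin.suc)))
  count-missing {suc n} h (Fin.suc j) hj≡false =
    ≤-trans (≤-reflexive (+-assoc (b2n (h Fin.zero)) _ 1))
            (+-mono-≤ (b2n≤1 (h Fin.zero)) (count-missing (h ∘ Fin.suc) j hj≡false))

  count-unique : ∀ {n} (h : Fin n → Bool) → (∀ i j → h i ≡ true → h j ≡ true → i ≡ j) →
    ∑[ i < n ] b2n (h i) ≤ 1
  count-unique {zero}  h unique = z≤n
  count-unique {suc n} h unique with h Fin.zero in h0
  ... | true  = ≤-reflexive (cong suc (trans (sum-cong-≗ (cong b2n ∘ others-false)) (sum-replicate-zero n)))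
    where
    others-false : ∀ i → h (Fin.suc i) ≡ false
    others-false i with h (Fin.suc i) in hi
    ... | true  = ⊥-elim (0F≢suc (unique Fin.zero (Fin.suc i) h0 hi))
    ... | false = refl
  ... | false = count-unique (h ∘ Fin.suc) (λ i j hi hj → fsuc-injective (unique (Fin.suc i) (Fin.suc j) hi hj))

  true≢false : true ≢ false
  true≢false ()

  ∧-elim : ∀ {a b} → a ∧ b ≡ true → a ≡ true × b ≡ true
  ∧-elim {true} {true} _ = refl , refl

  _==_ : ∀ {n} → Fin n → Fin n → Bool
  x == y = does (x ≟ y)

  ==-refl : ∀ {n} (x : Fin n) → x == x ≡ true
  ==-refl x with x ≟ x
  ... | yes _  = refl
  ... | no x≢x = ⊥-elim (x≢x refl)

  ==-sound : ∀ {n} {x y : Fin n} → x == y ≡ true → x ≡ y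
  ==-sound {x = x} {y} eq with x ≟ y
  ... | yes x≡y = x≡y

  ==-false : ∀ {n} {x y : Fin n} → x ≢ y → x == y ≡ false
  ==-false {x = x} {y} x≢y with x ≟ y
  ... | yes x≡y = ⊥-elim (x≢y x≡y)
  ... | no _    = refl

  -- Sums over a subset p ⊆ Fin n, written with the indicator `when (p x) (h x)`.

  when : Bool → ℕ → ℕ
  when b v = if b then v else 0

  when-mono : ∀ b {u v} → u ≤ v → when b u ≤ when b v
  when-mono true  u≤v = u≤v
  when-mono false _   = z≤n

  when-b2n : ∀ b c → when b (b2n c) ≡ b2n (b ∧ c)
  when-b2n true  c = refl
  when-b2n false c = refl

  when-∑ : ∀ b {n} (h : Fin n → ℕ) → when b (∑[ i < n ] h i) ≡ ∑[ i < n ] when b (h i)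
  when-∑ true      h = refl
  when-∑ false {n} h = sym (sum-replicate-zero n)

  when-when : ∀ a b v → when a (when b v) ≡ when b (when a v)
  when-when true  b     v = refl
  when-when false true  v = refl
  when-when false false v = refl

  when-when-+ : ∀ b c {u v t} → (b ≡ true → c ≡ true → u + v ≡ t) →
    when b (when c u) + when b (when c v) ≡ when b (when c t)
  when-when-+ true  true  u+v≡t = u+v≡t refl refl
  when-when-+ true  false _     = refl
  when-when-+ false c     _     = refl

  when-split : ∀ b c v → (c ≡ true → b ≡ true) → when b v ≡ when c v + when (b ∧ not c) v
  when-split true  true  v _   = sym (+-identityʳ v)
  when-split true  false v _   = refl
  when-split false true  v c⇒b with () ← c⇒b refl
  when-split false false v _   = refl

  ∑-point : ∀ {n} (a : Fin n) (h : Fin n → ℕ) → ∑[ x < n ] when (x == a) (h x) ≡ h a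
  ∑-point {suc n} Fin.zero    h = trans (cong (h Fin.zero +_) (sum-replicate-zero n)) (+-identityʳ (h Fin.zero))
  ∑-point {suc n} (Fin.suc a) h = ∑-point a (h ∘ Fin.suc)

  ∑-split : ∀ {n} (p : Fin n → Bool) (h : Fin n → ℕ) →
    ∑[ x < n ] h x ≡ ∑[ x < n ] when (not (p x)) (h x) + ∑[ x < n ] when (p x) (h x)
  ∑-split {n} p h = trans (sum-cong-≗ (λ x → split (p x) (h x))) (∑-distrib-+ {n} _ _)
    where
    split : ∀ b v → v ≡ when (not b) v + when b v
    split true  v = refl
    split false v = sym (+-identityʳ v)

  record Enumeration {n} (p : Fin n → Bool) (k : ℕ) : Set where
    field
      elem      : Fin k → Fin n
      injective : Injective _≡_ _≡_ elem
      elem-∈    : ∀ i → p (elem i) ≡ true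
      onto      : ∀ x → p x ≡ true → ∃ λ i → elem i ≡ x
  open Enumeration public

  dropFirst : ∀ {n k} {p : Fin n → Bool} (E : Enumeration p (suc k)) →
    Enumeration (λ x → p x ∧ not (x == elem E Fin.zero)) k
  dropFirst {p = p} E = record
    { elem      = elem E ∘ Fin.suc
    ; injective = fsuc-injective ∘ injective E
    ; elem-∈    = rest-∈
    ; onto      = rest-onto
    }
    where
    rest-∈ : ∀ i → p (elem E (Fin.suc i)) ∧ not (elem E (Fin.suc i) == elem E Fin.zero) ≡ true
    rest-∈ i = cong₂ (λ a b → a ∧ not b) (elem-∈ E (Fin.suc i))
                    (==-false (λ eq → 0F≢suc (sym (injective E eq))))
    rest-onto : ∀ x → p x ∧ not (x == elem E Fin.zero) ≡ true → ∃ λ i → elem E (Fin.suc i) ≡ x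
    rest-onto x px∧x≢e₀ with ∧-elim {p x} px∧x≢e₀
    ... | px , x≢e₀ with onto E x px
    ... | Fin.suc i , eq = i , eq
    ... | Fin.zero  , eq rewrite eq | ==-refl x with () ← x≢e₀

  ∑-enumeration : ∀ {n k} {p : Fin n → Bool} (E : Enumeration p k) (h : Fin n → ℕ) →
    ∑[ i < k ] h (elem E i) ≡ ∑[ x < n ] when (p x) (h x)
  ∑-enumeration {n} {zero} {p} E h = sym (trans (sum-cong-≗ outside) (sum-replicate-zero n))
    where
    outside : ∀ x → when (p x) (h x) ≡ 0
    outside x with p x in px
    ... | true with () ← proj₁ (onto E x px)
    ... | false = refl
  ∑-enumeration {n} {suc k} {p} E h = begin
      h e₀ + ∑[ i < k ] h (elem E (Fin.suc i))
    ≡⟨ cong₂ _+_ (sym (∑-point e₀ h)) (∑-enumeration (dropFirst E) h) ⟩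
      ∑[ x < n ] when (x == e₀) (h x) + ∑[ x < n ] when (p x ∧ not (x == e₀)) (h x)
    ≡⟨ sym (∑-distrib-+ {n} _ _) ⟩
      ∑[ x < n ] (when (x == e₀) (h x) + when (p x ∧ not (x == e₀)) (h x))
    ≡⟨ sum-cong-≗ (λ x → sym (when-split (p x) (x == e₀) (h x) (e₀-∈ x))) ⟩
      ∑[ x < n ] when (p x) (h x)
    ∎
    where
    open ≡-Reasoning
    e₀ : Fin n
    e₀ = elem E Fin.zero
    e₀-∈ : ∀ x → x == e₀ ≡ true → p x ≡ true
    e₀-∈ x x≡e₀ = subst (λ y → p y ≡ true) (sym (==-sound x≡e₀)) (elem-∈ E Fin.zero)

  count-enumeration : ∀ {n k} {p : Fin n → Bool} → Enumeration p k → ∑[ x < n ] when (p x) 1 ≡ k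
  count-enumeration {k = k} E = trans (sym (∑-enumeration E (λ _ → 1))) (trans (∑-const k 1) (*-identityʳ k))

  enumerate : ∀ {n} (p : Fin n → Bool) → ∃ (Enumeration p)
  enumerate {zero}  p = 0 , record { elem = λ () ; injective = λ { {()} } ; elem-∈ = λ () ; onto = λ () }
  enumerate {suc n} p with enumerate (p ∘ Fin.suc) | p Fin.zero in p₀
  ... | k , E | false = k , record
    { elem      = Fin.suc ∘ elem E
    ; injective = injective E ∘ fsuc-injective
    ; elem-∈    = elem-∈ E
    ; onto      = λ { Fin.zero p₀′ → ⊥-elim (true≢false (trans (sym p₀′) p₀))
                    ; (Fin.suc x) px → map₂ (cong Fin.suc) (onto E x px) }
    }
  ... | k , E | true = suc k , record
    { elem      = elem′
    ; injective = injective′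
    ; elem-∈    = λ { Fin.zero → p₀ ; (Fin.suc i) → elem-∈ E i }
    ; onto      = λ { Fin.zero _ → Fin.zero , refl
                    ; (Fin.suc x) px → map-× Fin.suc (cong Fin.suc) (onto E x px) }
    }
    where
    elem′ : Fin (suc k) → Fin (suc n)
    elem′ Fin.zero    = Fin.zero
    elem′ (Fin.suc i) = Fin.suc (elem E i)
    injective′ : Injective _≡_ _≡_ elem′
    injective′ {Fin.zero}  {Fin.zero}  _  = refl
    injective′ {Fin.suc i} {Fin.suc j} eq = cong Fin.suc (injective E (fsuc-injective eq))

  inImage : ∀ {k n} → (Fin k → Fin n) → Fin n → Bool
  inImage f x = does (any? (λ i → f i ≟ x))

  image-enumeration : ∀ {k n} (f : Fin k → Fin n) → Injective _≡_ _≡_ f → Enumeration (inImage f) k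
  image-enumeration f f-injective = record
    { elem = f ; injective = f-injective ; elem-∈ = in-image ; onto = image-onto }
    where
    in-image : ∀ i → inImage f (f i) ≡ true
    in-image i with any? (λ i′ → f i′ ≟ f i)
    ... | yes _  = refl
    ... | no ¬∃  = ⊥-elim (¬∃ (i , refl))
    image-onto : ∀ x → inImage f x ≡ true → ∃ λ i → f i ≡ x
    image-onto x _ with any? (λ i → f i ≟ x)
    image-onto x _  | yes x∈f = x∈f

  -- Double counting: edge sets as symmetric 0/1 matrices, split into blocks.

  pairs : ∀ {k} → (Fin k → Fin k → Bool) → ℕ
  pairs {k} M = ∑[ x < k ] ∑[ y < k ] b2n (M x y)

  pairs-mono : ∀ {k} {M N : Fin k → Fin k → Bool} → (∀ i j → M i j ≡ true → N i j ≡ true) → pairs M ≤ pairs N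
  pairs-mono M⇒N = ∑-mono (λ i → ∑-mono (λ j → b2n-mono (M⇒N i j)))
    where
    b2n-mono : ∀ {a b} → (a ≡ true → b ≡ true) → b2n a ≤ b2n b
    b2n-mono {false}         _   = z≤n
    b2n-mono {true}  {true}  _   = s≤s z≤n
    b2n-mono {true}  {false} a⇒b with () ← a⇒b refl

  pairs≤ : ∀ {k} (M : Fin k → Fin k → Bool) → pairs M ≤ k * k
  pairs≤ {k} M = ≤-trans (∑-mono (λ x → count≤ (M x))) (≤-reflexive (∑-const k k))

  -- the list sums in the definition of size are Fin-sums
  listSum-tabulate : ∀ {A : Set} {n} (f : A → ℕ) (g : Fin n → A) →
    List.sum (map f (tabulate g)) ≡ ∑[ i < n ] f (g i)
  listSum-tabulate {n = zero}  f g = refl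
  listSum-tabulate {n = suc n} f g = cong (f (g Fin.zero) +_) (listSum-tabulate f (g ∘ Fin.suc))

  split-by-order : ∀ {k} (M : Fin k → Fin k → Bool) → (∀ x y → M x y ≡ M y x) → (∀ x → M x x ≡ false) →
    ∀ x y → b2n (M x y) ≡ b2n (⌊ toℕ x <? toℕ y ⌋ ∧ M x y) + b2n (⌊ toℕ y <? toℕ x ⌋ ∧ M y x)
  split-by-order M symm loopless x y with toℕ x <? toℕ y | toℕ y <? toℕ x
  ... | yes x<y | yes y<x = ⊥-elim (<-asym x<y y<x)
  ... | yes _   | no _    = sym (+-identityʳ _)
  ... | no _    | yes _   = cong b2n (symm x y)
  ... | no x≮y  | no y≮x rewrite toℕ-injective (≤-antisym (≮⇒≥ y≮x) (≮⇒≥ x≮y)) | loopless y = refl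

  pairs-size : ∀ {k} {G : Graph k} (F : EdgeSet G) → pairs (mem F) ≡ 2 * size F
  pairs-size {k} {G} F = begin
      pairs (mem F)
    ≡⟨ sum-cong-≗ (λ x → sum-cong-≗ (split-by-order (mem F) (memSym F) loopless x)) ⟩
      ∑[ x < k ] ∑[ y < k ] (lower x y + lower y x)
    ≡⟨ sum-cong-≗ (λ x → ∑-distrib-+ (lower x) (λ y → lower y x)) ⟩
      ∑[ x < k ] (∑[ y < k ] lower x y + ∑[ y < k ] lower y x)
    ≡⟨ ∑-distrib-+ {k} _ _ ⟩
      ∑[ x < k ] ∑[ y < k ] lower x y + ∑[ x < k ] ∑[ y < k ] lower y x
    ≡⟨ cong (∑[ x < k ] ∑[ y < k ] lower x y +_) (∑-comm (λ x y → lower y x)) ⟩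
      ∑[ x < k ] ∑[ y < k ] lower x y + ∑[ x < k ] ∑[ y < k ] lower x y
    ≡⟨ cong (λ s → s + s) (sym size≡) ⟩
      size F + size F
    ≡⟨ cong (size F +_) (sym (+-identityʳ (size F))) ⟩
      2 * size F
    ∎
    where
    open ≡-Reasoning
    lower : Fin k → Fin k → ℕ
    lower x y = b2n (⌊ toℕ x <? toℕ y ⌋ ∧ mem F x y)
    loopless : ∀ x → mem F x x ≡ false
    loopless x with mem F x x in xx
    ... | true  with () ← trans (sym (⊆E F x x xx)) (irref G x)
    ... | false = refl
    size≡ : size F ≡ ∑[ x < k ] ∑[ y < k ] lower x y
    size≡ = trans (listSum-tabulate (λ x → List.sum (map (lower x) (allFin k))) (λ x → x))
                  (sum-cong-≗ (λ x → listSum-tabulate (lower x) (λ y → y)))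

  size≤ : ∀ {k} {G : Graph k} (F : EdgeSet G) → size F ≤ k * k
  size≤ F = ≤-trans (m≤m+n (size F) (size F + 0)) (≤-trans (≤-reflexive (sym (pairs-size F))) (pairs≤ (mem F)))

  block : ∀ {n} (p q : Fin n → Bool) (M : Fin n → Fin n → Bool) → ℕ
  block {n} p q M = ∑[ x < n ] when (p x) (∑[ y < n ] when (q y) (b2n (M x y)))

  block-entries : ∀ {n} (p q : Fin n → Bool) (M : Fin n → Fin n → Bool) →
    block p q M ≡ ∑[ x < n ] ∑[ y < n ] when (p x) (when (q y) (b2n (M x y)))
  block-entries p q M = sum-cong-≗ (λ x → when-∑ (p x) (λ y → when (q y) (b2n (M x y))))

  block-swap : ∀ {n} (p q : Fin n → Bool) (M : Fin n → Fin n → Bool) → (∀ x y → M x y ≡ M y x) →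
    block p q M ≡ block q p M
  block-swap {n} p q M symm = begin
      block p q M
    ≡⟨ block-entries p q M ⟩
      ∑[ x < n ] ∑[ y < n ] when (p x) (when (q y) (b2n (M x y)))
    ≡⟨ ∑-comm (λ x y → when (p x) (when (q y) (b2n (M x y)))) ⟩
      ∑[ y < n ] ∑[ x < n ] when (p x) (when (q y) (b2n (M x y)))
    ≡⟨ sum-cong-≗ (λ y → sum-cong-≗ (λ x → swap-entry x y)) ⟩
      ∑[ y < n ] ∑[ x < n ] when (q y) (when (p x) (b2n (M y x)))
    ≡⟨ block-entries q p M ⟨
      block q p M
    ∎
    where
    open ≡-Reasoning
    swap-entry : ∀ x y → when (p x) (when (q y) (b2n (M x y))) ≡ when (q y) (when (p x) (b2n (M y x)))
    swap-entry x y = trans (when-when (p x) (q y) _) (cong (λ b → when (q y) (when (p x) (b2n b))) (symm x y))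

  pairs-blocks : ∀ {n} (p : Fin n → Bool) (M : Fin n → Fin n → Bool) → (∀ x y → M x y ≡ M y x) →
    pairs M ≡ block (not ∘ p) (not ∘ p) M + 2 * block (not ∘ p) p M + block p p M
  pairs-blocks {n} p M symm = begin
      pairs M
    ≡⟨ sum-cong-≗ (λ x → ∑-split p (λ y → b2n (M x y))) ⟩
      ∑[ x < n ] (outRow x + inRow x)
    ≡⟨ ∑-distrib-+ outRow inRow ⟩
      ∑[ x < n ] outRow x + ∑[ x < n ] inRow x
    ≡⟨ cong₂ _+_ (∑-split p outRow) (∑-split p inRow) ⟩
      (block p̄ p̄ M + block p p̄ M) + (block p̄ p M + block p p M)
    ≡⟨ cong (λ b → (block p̄ p̄ M + b) + (block p̄ p M + block p p M)) (block-swap p p̄ M symm) ⟩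
      (block p̄ p̄ M + block p̄ p M) + (block p̄ p M + block p p M)
    ≡⟨ solve 3 (λ a b c → (a :+ b) :+ (b :+ c) := a :+ con 2 :* b :+ c) refl
               (block p̄ p̄ M) (block p̄ p M) (block p p M) ⟩
      block p̄ p̄ M + 2 * block p̄ p M + block p p M
    ∎
    where
    open ≡-Reasoning
    open +-*-Solver
    p̄ : Fin n → Bool
    p̄ = not ∘ p
    outRow inRow : Fin n → ℕ
    outRow x = ∑[ y < n ] when (not (p y)) (b2n (M x y))
    inRow  x = ∑[ y < n ] when (p y) (b2n (M x y))

  block-enumeration : ∀ {n k} {p : Fin n → Bool} (E : Enumeration p k) (M : Fin n → Fin n → Bool) →
    block p p M ≡ pairs (λ i j → M (elem E i) (elem E j))
  block-enumeration {n} {k} {p} E M =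
    trans (sum-cong-≗ (λ x → cong (when (p x)) (sym (∑-enumeration E (λ y → b2n (M x y))))))
          (sym (∑-enumeration E (λ x → ∑[ j < k ] b2n (M x (elem E j)))))

  parity : ℕ → Bool
  parity zero    = false
  parity (suc k) = not (parity k)

  same : Bool → Bool → Bool
  same a b = not (a xor b)

  same-refl : ∀ a → same a a ≡ true
  same-refl a = cong not (xor-same a)

  same-sym : ∀ a b → same a b ≡ same b a
  same-sym a b = cong not (xor-comm a b)

  same-sound : ∀ {a b} → same a b ≡ true → a ≡ b
  same-sound {true}  {true}  _ = refl
  same-sound {false} {false} _ = refl

  same-xor : ∀ a b s → same (a xor s) (b xor s) ≡ same a b
  same-xor true  true  true  = refl
  same-xor true  true  false = refl
  same-xor true  false true  = refl
  same-xor true  false false = refl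
  same-xor false true  true  = refl
  same-xor false true  false = refl
  same-xor false false true  = refl
  same-xor false false false = refl

  same-not : ∀ a b → same (not a) (not b) ≡ same a b
  same-not a b = cong not (xor-annihilates-not a b)

  odds evens : ℕ → ℕ
  odds  w = ∑[ j < w ] b2n (parity (toℕ j))
  evens w = ∑[ j < w ] b2n (not (parity (toℕ j)))

  odds≤evens≤1+odds : ∀ w → odds w ≤ evens w × evens w ≤ suc (odds w)
  odds≤evens≤1+odds zero    = z≤n , z≤n
  odds≤evens≤1+odds (suc w) with odds≤evens≤1+odds w
  ... | o≤e , e≤1+o = subst (evens w ≤_) (sym evens-suc) e≤1+o , subst (_≤ suc (evens w)) (sym evens-suc) (s≤s o≤e)
    where
    evens-suc : evens (suc w) ≡ suc (odds w)
    evens-suc = cong suc (sum-cong-≗ {w} (λ j → cong b2n (not-involutive (parity (toℕ j)))))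

  odds+evens : ∀ w → odds w + evens w ≡ w
  odds+evens w = begin
      odds w + evens w
    ≡⟨ ∑-distrib-+ (λ j → b2n (p j)) (λ j → b2n (not (p j))) ⟨
      ∑[ j < w ] (b2n (p j) + b2n (not (p j)))
    ≡⟨ sum-cong-≗ (λ j → one (p j)) ⟩
      ∑[ j < w ] 1
    ≡⟨ trans (∑-const w 1) (*-identityʳ w) ⟩
      w
    ∎
    where
    open ≡-Reasoning
    p : Fin w → Bool
    p j = parity (toℕ j)
    one : ∀ b → b2n b + b2n (not b) ≡ 1
    one true  = refl
    one false = refl

  2*odds≤ : ∀ w → 2 * odds w ≤ w
  2*odds≤ w = begin
      2 * odds w              ≡⟨ cong (odds w +_) (+-identityʳ (odds w)) ⟩
      odds w + odds w         ≤⟨ +-monoʳ-≤ (odds w) (proj₁ (odds≤evens≤1+odds w)) ⟩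
      odds w + evens w        ≡⟨ odds+evens w ⟩
      w                       ∎
    where open ≤-Reasoning

  sameParity : ∀ {w} → Fin w → Fin w → Bool
  sameParity j j' = not (j == j') ∧ same (parity (toℕ j)) (parity (toℕ j'))

  -- removing index 0 loses the pairs (0 , j) and (j , 0) with j odd
  sameParity-suc : ∀ w → pairs (sameParity {suc w}) ≡ odds w + (odds w + pairs (sameParity {w}))
  sameParity-suc w = begin
      pairs (sameParity {suc w})
    ≡⟨⟩
      ∑[ j < w ] b2n (not (not (p j))) + ∑[ j < w ] (b2n (same (not (p j)) false) + row j)
    ≡⟨ cong₂ _+_ (sum-cong-≗ (λ j → cong b2n (not-involutive (p j))))
                 (∑-distrib-+ (λ j → b2n (same (not (p j)) false)) row) ⟩
      odds w + (∑[ j < w ] b2n (same (not (p j)) false) + ∑[ j < w ] row j)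
    ≡⟨ cong (λ s → odds w + (s + ∑[ j < w ] row j)) (sum-cong-≗ (λ j → column-zero (p j))) ⟩
      odds w + (odds w + ∑[ j < w ] row j)
    ≡⟨ cong (λ s → odds w + (odds w + s)) (sum-cong-≗ (λ j → sum-cong-≗ (λ j' → cong (λ b → b2n (not (j == j') ∧ b)) (same-not (p j) (p j'))))) ⟩
      odds w + (odds w + pairs (sameParity {w}))
    ∎
    where
    open ≡-Reasoning
    p : Fin w → Bool
    p j = parity (toℕ j)
    row : Fin w → ℕ
    row j = ∑[ j' < w ] b2n (not (j == j') ∧ same (not (p j)) (not (p j')))
    column-zero : ∀ b → b2n (same (not b) false) ≡ b2n b
    column-zero true  = refl
    column-zero false = refl

  sameParity-bound : ∀ w → 2 * pairs (sameParity {w}) + w ≤ w * w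
  sameParity-bound zero    = z≤n
  sameParity-bound (suc w) = begin
      2 * pairs (sameParity {suc w}) + suc w
    ≡⟨ cong (λ s → 2 * s + suc w) (sameParity-suc w) ⟩
      2 * (o + (o + T)) + suc w
    ≡⟨ solve 3 (λ o T w → con 2 :* (o :+ (o :+ T)) :+ (con 1 :+ w) := con 2 :* (con 2 :* o) :+ (con 2 :* T :+ w) :+ con 1) refl o T w ⟩
      2 * (2 * o) + (2 * T + w) + 1
    ≤⟨ +-monoˡ-≤ 1 (+-mono-≤ (*-monoʳ-≤ 2 (2*odds≤ w)) (sameParity-bound w)) ⟩
      2 * w + w * w + 1
    ≡⟨ solve 1 (λ w → con 2 :* w :+ w :* w :+ con 1 := (con 1 :+ w) :* (con 1 :+ w)) refl w ⟩
      suc w * suc w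
    ∎
    where
    open ≤-Reasoning
    open +-*-Solver
    o T : ℕ
    o = odds w
    T = pairs (sameParity {w})

  clique-extend : ∀ {n k} {G : Graph n} {K : Fin k → Fin n} (x : Fin n) → IsClique G K →
    (∀ j → adj G x (K j) ≡ true) → IsClique G (x ∷ K)
  clique-extend {G = G} {K} x (K-injective , K-adjacent) x~K = extended-injective , extended-adjacent
    where
    x∉K : ∀ j → K j ≢ x
    x∉K j Kj≡x = true≢false (trans (sym (x~K j)) (trans (cong (adj G x) Kj≡x) (irref G x)))
    extended-injective : Injective _≡_ _≡_ (x ∷ K)
    extended-injective {Fin.zero}  {Fin.zero}  _  = refl
    extended-injective {Fin.zero}  {Fin.suc j} eq = ⊥-elim (x∉K j (sym eq))
    extended-injective {Fin.suc i} {Fin.zero}  eq = ⊥-elim (x∉K i eq)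
    extended-injective {Fin.suc i} {Fin.suc j} eq = cong Fin.suc (K-injective eq)
    extended-adjacent : ∀ i j → i ≢ j → adj G ((x ∷ K) i) ((x ∷ K) j) ≡ true
    extended-adjacent Fin.zero    Fin.zero    i≢j = ⊥-elim (i≢j refl)
    extended-adjacent Fin.zero    (Fin.suc j) _   = x~K j
    extended-adjacent (Fin.suc i) Fin.zero    _   = trans (adj-sym G (K i) x) (x~K i)
    extended-adjacent (Fin.suc i) (Fin.suc j) i≢j = K-adjacent i j (i≢j ∘ cong Fin.suc)

  module CliqueComplement {n} (G : Graph n) {w} (K : Fin w → Fin n) (K-clique : IsClique G K)
    (K-maximum : ∀ k (f : Fin k → Fin n) → IsClique G f → k ≤ w) where

    inK outK : Fin n → Bool
    inK  = inImage K
    outK = not ∘ inK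

    K-enumeration : Enumeration inK w
    K-enumeration = image-enumeration K (proj₁ K-clique)

    m : ℕ
    m = proj₁ (enumerate outK)

    H-enumeration : Enumeration outK m
    H-enumeration = proj₂ (enumerate outK)

    vertexH : Fin m → Fin n
    vertexH = elem H-enumeration

    H : Graph m
    H = induced G vertexH (injective H-enumeration)

    m+w≡n : m + w ≡ n
    m+w≡n = begin
        m + w
      ≡⟨ cong₂ _+_ (count-enumeration H-enumeration) (count-enumeration K-enumeration) ⟨
        ∑[ x < n ] when (outK x) 1 + ∑[ x < n ] when (inK x) 1
      ≡⟨ ∑-split inK (λ _ → 1) ⟨
        ∑[ x < n ] 1
      ≡⟨ trans (∑-const n 1) (*-identityʳ n) ⟩
        n
      ∎
      where open ≡-Reasoning

    K-adjacent : ∀ {y y′} → inK y ≡ true → inK y′ ≡ true → y ≢ y′ → adj G y y′ ≡ true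
    K-adjacent {y} {y′} y∈K y′∈K y≢y′ with onto K-enumeration y y∈K | onto K-enumeration y′ y′∈K
    ... | j , refl | j′ , refl = proj₂ K-clique j j′ (y≢y′ ∘ cong K)

    -- by maximality of K, a vertex outside K misses some vertex of K
    K-neighbours : ∀ x → outK x ≡ true → ∑[ y < n ] when (inK y) (b2n (adj G x y)) + 1 ≤ w
    K-neighbours x x∉K with all? (λ j → adj G x (K j) Bool.≟ true)
    ... | yes x~K = ⊥-elim (1+n≰n (K-maximum (suc w) (x ∷ K) (clique-extend {G = G} x K-clique x~K)))
    ... | no ¬x~K with ¬∀⟶∃¬ w _ (λ j → adj G x (K j) Bool.≟ true) ¬x~K
    ... | j , x≁Kj = subst (λ s → s + 1 ≤ w) (∑-enumeration K-enumeration (λ y → b2n (adj G x y)))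
                           (count-missing (λ j → adj G x (K j)) j (¬-not x≁Kj))

    restrict : EdgeSet G → EdgeSet H
    restrict F = record
      { mem    = λ i j → mem F (vertexH i) (vertexH j)
      ; memSym = λ i j → memSym F (vertexH i) (vertexH j)
      ; ⊆E     = λ i j → ⊆E F (vertexH i) (vertexH j)
      }

    restrict-independent : ∀ {F : EdgeSet G} → TriangleIndependent F → TriangleIndependent (restrict F)
    restrict-independent independent i j k = independent (vertexH i) (vertexH j) (vertexH k)

    -- two edges xy, xy′ of F into K would lie in the triangle x y y′
    one-edge-into-K : ∀ {F : EdgeSet G} → TriangleIndependent F →
      ∀ x → ∑[ y < n ] when (inK y) (b2n (mem F x y)) ≤ 1
    one-edge-into-K {F} independent x = begin
        ∑[ y < n ] when (inK y) (b2n (mem F x y))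
      ≡⟨ sum-cong-≗ (λ y → when-b2n (inK y) (mem F x y)) ⟩
        ∑[ y < n ] b2n (inK y ∧ mem F x y)
      ≤⟨ count-unique (λ y → inK y ∧ mem F x y) unique ⟩
        1
      ∎
      where
      open ≤-Reasoning
      unique : ∀ y y′ → inK y ∧ mem F x y ≡ true → inK y′ ∧ mem F x y′ ≡ true → y ≡ y′
      unique y y′ xy xy′ with ∧-elim {inK y} xy | ∧-elim {inK y′} xy′ | y ≟ y′
      ... | _ , _ | _ , _ | yes y≡y′ = y≡y′
      ... | y∈K , xy∈F | y′∈K , xy′∈F | no y≢y′ = ⊥-elim (two-edges (mem F y y′)
              (subst₂ (λ a b → b2n a + b2n (mem F y y′) + b2n b ≤ 1) xy∈F xy′∈F
                (independent x y y′ (⊆E F x y xy∈F) (K-adjacent y∈K y′∈K y≢y′) (⊆E F x y′ xy′∈F))))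
        where
        two-edges : ∀ b → ¬ (1 + b2n b + 1 ≤ 1)
        two-edges true  (s≤s ())
        two-edges false (s≤s ())

    block-into-K : ∀ {F : EdgeSet G} → TriangleIndependent F → ∀ p →
      block p inK (mem F) ≤ ∑[ x < n ] when (p x) 1
    block-into-K {F} independent p = ∑-mono (λ x → when-mono (p x) (one-edge-into-K {F} independent x))

    α-bound : ∀ {F : EdgeSet G} → TriangleIndependent F → 2 * size F ≤ 2 * size (restrict F) + 2 * m + w
    α-bound {F} independent = begin
        2 * size F
      ≡⟨ pairs-size F ⟨
        pairs (mem F)
      ≡⟨ pairs-blocks inK (mem F) (memSym F) ⟩
        block outK outK (mem F) + 2 * block outK inK (mem F) + block inK inK (mem F)
      ≤⟨ +-mono-≤ (+-monoʳ-≤ (block outK outK (mem F)) (*-monoʳ-≤ 2 (into-K outK H-enumeration)))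
                  (into-K inK K-enumeration) ⟩
        block outK outK (mem F) + 2 * m + w
      ≡⟨ cong (λ s → s + 2 * m + w) (trans (block-enumeration H-enumeration (mem F)) (pairs-size (restrict F))) ⟩
        2 * size (restrict F) + 2 * m + w
      ∎
      where
      open ≤-Reasoning
      into-K : ∀ {k} p → Enumeration p k → block p inK (mem F) ≤ k
      into-K p E = ≤-trans (block-into-K {F} independent p) (≤-reflexive (count-enumeration E))

    -- every vertex of H has at most w − 1 neighbours in K
    cross-edges : block outK inK (adj G) + m ≤ m * w
    cross-edges = begin
        block outK inK (adj G) + m
      ≡⟨ cong (block outK inK (adj G) +_) (count-enumeration H-enumeration) ⟨
        ∑[ x < n ] when (outK x) (row x) + ∑[ x < n ] when (outK x) 1
      ≡⟨ ∑-distrib-+ (λ x → when (outK x) (row x)) (λ x → when (outK x) 1) ⟨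
        ∑[ x < n ] (when (outK x) (row x) + when (outK x) 1)
      ≤⟨ ∑-mono bounded-row ⟩
        ∑[ x < n ] when (outK x) w
      ≡⟨ ∑-enumeration H-enumeration (λ _ → w) ⟨
        ∑[ i < m ] w
      ≡⟨ ∑-const m w ⟩
        m * w
      ∎
      where
      open ≤-Reasoning
      row : Fin n → ℕ
      row x = ∑[ y < n ] when (inK y) (b2n (adj G x y))
      bounded-row : ∀ x → when (outK x) (row x) + when (outK x) 1 ≤ when (outK x) w
      bounded-row x with outK x in x∉K
      ... | true  = K-neighbours x x∉K
      ... | false = z≤n

    -- Bipartite deletion sets: extend a 2-colouring of H − D by the alternating colouring of K,
    -- possibly with its colours swapped (s = true).
    module ExtendColouring (D : EdgeSet H) (D-bipartite : BipartiteAfterDeleting H D) where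

      colourH : Fin m → Bool
      colourH = proj₁ D-bipartite

      colourAt : Bool → ∀ x (b : Bool) → inK x ≡ b → Bool
      colourAt s x true  x∈K = parity (toℕ (proj₁ (onto K-enumeration x x∈K))) xor s
      colourAt s x false x∉K = colourH (proj₁ (onto H-enumeration x (cong not x∉K)))

      colour : Bool → Fin n → Bool
      colour s x = colourAt s x (inK x) refl

      colour-K : ∀ s j → colour s (K j) ≡ parity (toℕ j) xor s
      colour-K s j = at-K (inK (K j)) refl
        where
        at-K : ∀ b (e : inK (K j) ≡ b) → colourAt s (K j) b e ≡ parity (toℕ j) xor s
        at-K true  Kj∈K = cong (λ i → parity (toℕ i) xor s)
                               (injective K-enumeration (proj₂ (onto K-enumeration (K j) Kj∈K)))
        at-K false Kj∉K with () ← trans (sym (elem-∈ K-enumeration j)) Kj∉K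

      colour-H : ∀ s i → colour s (vertexH i) ≡ colourH i
      colour-H s i = at-H (inK (vertexH i)) refl
        where
        at-H : ∀ b (e : inK (vertexH i) ≡ b) → colourAt s (vertexH i) b e ≡ colourH i
        at-H true  vi∈K with () ← trans (sym (elem-∈ H-enumeration i)) (cong not vi∈K)
        at-H false vi∉K = cong colourH (injective H-enumeration (proj₂ (onto H-enumeration (vertexH i) (cong not vi∉K))))

      monochromatic : Bool → Fin n → Fin n → Bool
      monochromatic s x y = adj G x y ∧ same (colour s x) (colour s y)

      mono : Bool → EdgeSet G
      mono s = record
        { mem    = monochromatic s
        ; memSym = λ x y → cong₂ _∧_ (adj-sym G x y) (same-sym (colour s x) (colour s y))
        ; ⊆E     = λ x y xy → proj₁ (∧-elim {adj G x y} xy)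
        }

      mono-bipartite : ∀ s → BipartiteAfterDeleting G (mono s)
      mono-bipartite s = colour s , λ x y x~y not-mono same-colour →
        true≢false (trans (sym (mono-if-same x y x~y same-colour)) not-mono)
        where
        mono-if-same : ∀ x y → adj G x y ≡ true → colour s x ≡ colour s y → monochromatic s x y ≡ true
        mono-if-same x y x~y cx≡cy rewrite x~y | cx≡cy = same-refl (colour s y)

      -- inside H the colouring is that of H − D, so monochromatic edges lie in D
      H-block : ∀ s → block outK outK (monochromatic s) ≤ 2 * size D
      H-block s = begin
          block outK outK (monochromatic s)
        ≡⟨ block-enumeration H-enumeration (monochromatic s) ⟩
          pairs (λ i j → monochromatic s (vertexH i) (vertexH j))
        ≤⟨ pairs-mono in-D ⟩
          pairs (mem D)
        ≡⟨ pairs-size D ⟩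
          2 * size D
        ∎
        where
        open ≤-Reasoning
        in-D : ∀ i j → monochromatic s (vertexH i) (vertexH j) ≡ true → mem D i j ≡ true
        in-D i j ij-mono with ∧-elim {adj G (vertexH i) (vertexH j)} ij-mono | mem D i j in ij∈D
        ... | _     , _       | true  = refl
        ... | vi~vj , same-ij | false = ⊥-elim (proj₂ D-bipartite i j vi~vj ij∈D
                (trans (sym (colour-H s i)) (trans (same-sound same-ij) (colour-H s j))))

      -- inside K a monochromatic edge joins distinct vertices of equal parity
      K-block : ∀ s → block inK inK (monochromatic s) ≤ pairs (sameParity {w})
      K-block s = ≤-trans (≤-reflexive (block-enumeration K-enumeration (monochromatic s))) (pairs-mono equal-parity)
        where
        equal-parity : ∀ j j′ → monochromatic s (K j) (K j′) ≡ true → sameParity j j′ ≡ true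
        equal-parity j j′ jj′-mono with ∧-elim {adj G (K j) (K j′)} jj′-mono | j == j′ in j≡j′
        ... | Kj~Kj′ , _ | true = ⊥-elim (true≢false (trans (sym Kj~Kj′)
                (trans (cong (λ i → adj G (K j) (K i)) (sym (==-sound j≡j′))) (irref G (K j)))))
        ... | _ , same-jj′ | false = trans (sym (trans (cong₂ same (colour-K s j) (colour-K s j′))
                (same-xor (parity (toℕ j)) (parity (toℕ j′)) s))) same-jj′

      -- an H–K edge is monochromatic in exactly one of the two colourings
      exactly-one : ∀ a u v → b2n (a ∧ same u (v xor false)) + b2n (a ∧ same u (v xor true)) ≡ b2n a
      exactly-one false u     v     = refl
      exactly-one true  true  true  = refl
      exactly-one true  true  false = refl
      exactly-one true  false true  = refl
      exactly-one true  false false = refl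

      cross-entry : ∀ x y → when (outK x) (when (inK y) (b2n (monochromatic false x y)))
                          + when (outK x) (when (inK y) (b2n (monochromatic true x y)))
                          ≡ when (outK x) (when (inK y) (b2n (adj G x y)))
      cross-entry x y = when-when-+ (outK x) (inK y)
        (λ x∉K y∈K → H-to-K (onto H-enumeration x x∉K) (onto K-enumeration y y∈K))
        where
        H-to-K : ∀ {x y} → ∃ (λ i → vertexH i ≡ x) → ∃ (λ j → K j ≡ y) →
          b2n (monochromatic false x y) + b2n (monochromatic true x y) ≡ b2n (adj G x y)
        H-to-K (i , refl) (j , refl)
          rewrite colour-H false i | colour-H true i | colour-K false j | colour-K true j =
          exactly-one (adj G (vertexH i) (K j)) (colourH i) (parity (toℕ j))

      cross-blocks : block outK inK (monochromatic false) + block outK inK (monochromatic true)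
                   ≡ block outK inK (adj G)
      cross-blocks = begin
          block outK inK (monochromatic false) + block outK inK (monochromatic true)
        ≡⟨ cong₂ _+_ (block-entries outK inK (monochromatic false)) (block-entries outK inK (monochromatic true)) ⟩
          ∑[ x < n ] ∑[ y < n ] entry false x y + ∑[ x < n ] ∑[ y < n ] entry true x y
        ≡⟨ ∑-distrib-+ (λ x → ∑[ y < n ] entry false x y) (λ x → ∑[ y < n ] entry true x y) ⟨
          ∑[ x < n ] (∑[ y < n ] entry false x y + ∑[ y < n ] entry true x y)
        ≡⟨ sum-cong-≗ (λ x → trans (sym (∑-distrib-+ (entry false x) (entry true x))) (sum-cong-≗ (cross-entry x))) ⟩
          ∑[ x < n ] ∑[ y < n ] when (outK x) (when (inK y) (b2n (adj G x y)))
        ≡⟨ block-entries outK inK (adj G) ⟨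
          block outK inK (adj G)
        ∎
        where
        open ≡-Reasoning
        entry : Bool → Fin n → Fin n → ℕ
        entry s x y = when (outK x) (when (inK y) (b2n (monochromatic s x y)))

      mono-bound : ∀ s → 2 * size (mono s) ≤ 2 * size D + 2 * block outK inK (monochromatic s) + pairs (sameParity {w})
      mono-bound s = begin
          2 * size (mono s)
        ≡⟨ pairs-size (mono s) ⟨
          pairs (monochromatic s)
        ≡⟨ pairs-blocks inK (monochromatic s) (memSym (mono s)) ⟩
          block outK outK (monochromatic s) + 2 * block outK inK (monochromatic s) + block inK inK (monochromatic s)
        ≤⟨ +-mono-≤ (+-monoˡ-≤ _ (H-block s)) (K-block s) ⟩
          2 * size D + 2 * block outK inK (monochromatic s) + pairs (sameParity {w})
        ∎
        where open ≤-Reasoning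

      -- averaging over the two colourings: τ_B(G) ≤ size D + m(w − 1)/2 + (w² − w)/4
      τ-bound : ∀ {t} → (∀ F → BipartiteAfterDeleting G F → t ≤ size F) →
        4 * t + 2 * m + w ≤ 4 * size D + 2 * m * w + w * w
      τ-bound {t} t-minimum = begin
          4 * t + 2 * m + w
        ≡⟨ solve 3 (λ t m w → con 4 :* t :+ con 2 :* m :+ w := con 2 :* t :+ con 2 :* t :+ (con 2 :* m :+ w)) refl t m w ⟩
          2 * t + 2 * t + (2 * m + w)
        ≤⟨ +-monoˡ-≤ (2 * m + w) (+-mono-≤ (t≤mono false) (t≤mono true)) ⟩
          2 * size (mono false) + 2 * size (mono true) + (2 * m + w)
        ≤⟨ +-monoˡ-≤ (2 * m + w) (+-mono-≤ (mono-bound false) (mono-bound true)) ⟩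
          (2 * d + 2 * h₀ + T) + (2 * d + 2 * h₁ + T) + (2 * m + w)
        ≡⟨ solve 6 (λ d h₀ h₁ T m w → (con 2 :* d :+ con 2 :* h₀ :+ T) :+ (con 2 :* d :+ con 2 :* h₁ :+ T) :+ (con 2 :* m :+ w)
                                     := con 4 :* d :+ con 2 :* (h₀ :+ h₁ :+ m) :+ (con 2 :* T :+ w)) refl d h₀ h₁ T m w ⟩
          4 * d + 2 * (h₀ + h₁ + m) + (2 * T + w)
        ≤⟨ +-mono-≤ (+-monoʳ-≤ (4 * d) (*-monoʳ-≤ 2 cross)) (sameParity-bound w) ⟩
          4 * d + 2 * (m * w) + w * w
        ≡⟨ cong (λ s → 4 * d + s + w * w) (sym (*-assoc 2 m w)) ⟩
          4 * d + 2 * m * w + w * w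
        ∎
        where
        open ≤-Reasoning
        open +-*-Solver
        d h₀ h₁ T : ℕ
        d  = size D
        h₀ = block outK inK (monochromatic false)
        h₁ = block outK inK (monochromatic true)
        T  = pairs (sameParity {w})
        t≤mono : ∀ s → 2 * t ≤ 2 * size (mono s)
        t≤mono s = *-monoʳ-≤ 2 (t-minimum (mono s) (mono-bipartite s))
        cross : h₀ + h₁ + m ≤ m * w
        cross = subst (λ h → h + m ≤ m * w) (sym cross-blocks) cross-edges

    α+τ-bound : ∀ {a t A τ} → IsAlpha1 G a → IsTauB G t → IsAlpha1 H A → IsTauB H τ →
      4 * (a + t) ≤ 4 * (A + τ) + 2 * m * (w + 1) + w * (w + 1)
    α+τ-bound {a} {t} {A} {τ} ((F , F-independent , |F|≡a) , _) (_ , t-minimum) (_ , A-maximum)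
              ((D , D-bipartite , |D|≡τ) , _) = +-cancelʳ-≤ (2 * m + w) _ _ (begin
        4 * (a + t) + (2 * m + w)
      ≡⟨ solve 4 (λ a t m w → con 4 :* (a :+ t) :+ (con 2 :* m :+ w)
                           := con 2 :* (con 2 :* a) :+ (con 4 :* t :+ con 2 :* m :+ w)) refl a t m w ⟩
        2 * (2 * a) + (4 * t + 2 * m + w)
      ≤⟨ +-mono-≤ (*-monoʳ-≤ 2 α-estimate) τ-estimate ⟩
        2 * (2 * A + 2 * m + w) + (4 * τ + 2 * m * w + w * w)
      ≡⟨ solve 4 (λ A τ m w → con 2 :* (con 2 :* A :+ con 2 :* m :+ w) :+ (con 4 :* τ :+ con 2 :* m :* w :+ w :* w)
                           := con 4 :* (A :+ τ) :+ con 2 :* m :* (w :+ con 1) :+ w :* (w :+ con 1) :+ (con 2 :* m :+ w))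
               refl A τ m w ⟩
        4 * (A + τ) + 2 * m * (w + 1) + w * (w + 1) + (2 * m + w)
      ∎)
      where
      open ≤-Reasoning
      open +-*-Solver
      α-estimate : 2 * a ≤ 2 * A + 2 * m + w
      α-estimate = begin
          2 * a                                ≡⟨ cong (2 *_) |F|≡a ⟨
          2 * size F                           ≤⟨ α-bound {F} F-independent ⟩
          2 * size (restrict F) + 2 * m + w    ≤⟨ +-monoˡ-≤ w (+-monoˡ-≤ (2 * m) (*-monoʳ-≤ 2
                                                    (A-maximum (restrict F) (restrict-independent {F} F-independent)))) ⟩
          2 * A + 2 * m + w                    ∎
      τ-estimate : 4 * t + 2 * m + w ≤ 4 * τ + 2 * m * w + w * w
      τ-estimate = subst (λ d → 4 * t + 2 * m + w ≤ 4 * d + 2 * m * w + w * w) |D|≡τ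
                     (ExtendColouring.τ-bound D D-bipartite t-minimum)

  -- Classical existence of α₁ and τ_B (they are extrema over all edge sets).

  ¬¬-largest : ∀ (P : ℕ → Set) B → (∀ k → P k → k ≤ B) → ∃ P → ¬ ¬ (∃ λ k → P k × (∀ j → P j → j ≤ k))
  ¬¬-largest P zero    bounded (k , Pk) refute = refute (k , Pk , λ j Pj → ≤-trans (bounded j Pj) z≤n)
  ¬¬-largest P (suc B) bounded ∃P       refute = ¬¬-excluded-middle λ
    { (yes P[1+B]) → refute (suc B , P[1+B] , bounded)
    ; (no ¬P[1+B]) → ¬¬-largest P B (below ¬P[1+B]) ∃P refute }
    where
    below : ¬ P (suc B) → ∀ k → P k → k ≤ B
    below ¬P[1+B] k Pk = ≤-pred (≤∧≢⇒< (bounded k Pk) (λ { refl → ¬P[1+B] Pk }))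

  -- a nonempty set of naturals classically has a smallest element: its largest lower bound
  ¬¬-smallest : ∀ (P : ℕ → Set) → ∃ P → ¬ ¬ (∃ λ k → P k × (∀ j → P j → k ≤ j))
  ¬¬-smallest P (k₀ , Pk₀) refute =
    ¬¬-largest LowerBound k₀ (λ k k≤P → k≤P k₀ Pk₀) (0 , λ _ _ → z≤n) λ
      { (L , L≤P , largest) → ¬¬-excluded-middle λ
        { (yes PL) → refute (L , PL , L≤P)
        ; (no ¬PL) → 1+n≰n (largest (suc L) (λ j Pj → ≤∧≢⇒< (L≤P j Pj) (λ { refl → ¬PL Pj }))) } }
    where
    LowerBound : ℕ → Set
    LowerBound k = ∀ j → P j → k ≤ j

  -- α₁(H) exists: the empty set is triangle-independent and every edge set has at most k² edges
  ¬¬-α₁ : ∀ {k} (H : Graph k) → ¬ ¬ ∃ (IsAlpha1 H)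
  ¬¬-α₁ {k} H refute =
    ¬¬-largest Achieved (k * k) (λ j (F , _ , |F|≡j) → subst (_≤ k * k) |F|≡j (size≤ F))
               (size no-edges , no-edges , (λ _ _ _ _ _ _ → z≤n) , refl)
      λ { (A , achieved , largest) → refute (A , achieved , λ F F-independent → largest (size F) (F , F-independent , refl)) }
    where
    Achieved : ℕ → Set
    Achieved j = Σ (EdgeSet H) λ F → TriangleIndependent F × size F ≡ j
    no-edges : EdgeSet H
    no-edges = record { mem = λ _ _ → false ; memSym = λ _ _ → refl ; ⊆E = λ _ _ () }

  -- τ_B(H) exists: deleting all edges leaves a bipartite graph
  ¬¬-τ_B : ∀ {k} (H : Graph k) → ¬ ¬ ∃ (IsTauB H)
  ¬¬-τ_B {k} H refute =
    ¬¬-smallest Achieved (size all-edges , all-edges , all-deleted , refl)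
      λ { (τ , achieved , smallest) → refute (τ , achieved , λ F F-bipartite → smallest (size F) (F , F-bipartite , refl)) }
    where
    Achieved : ℕ → Set
    Achieved j = Σ (EdgeSet H) λ F → BipartiteAfterDeleting H F × size F ≡ j
    all-edges : EdgeSet H
    all-edges = record { mem = adj H ; memSym = adj-sym H ; ⊆E = λ _ _ xy → xy }
    all-deleted : BipartiteAfterDeleting H all-edges
    all-deleted = (λ _ → true) , λ x y x~y x≁y _ → true≢false (trans (sym x~y) x≁y)

module RationalBounds where

  import Data.Nat as ℕ
  open import Data.Integer as ℤ using (+_)
  import Data.Integer.Properties as ℤ
  open import Data.Rational
    using (ℚ; mkℚ; _/_; _+_; _*_; _-_; -_; _≤_; _<_; 1/_; NonZero; Positive; NonNegative; 0ℚ; 1ℚ; positive; *≤*)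
  open import Data.Rational.Properties
  open import Data.Rational.Solver using (module +-*-Solver)
  open import Data.Nat.Coprimality using (1-coprimeTo) renaming (sym to coprime-sym)
  open import Relation.Binary.PropositionalEquality using (_≡_; refl; sym; trans; cong; cong₂)
  open import Relation.Nullary using (¬_)

  ℕ→ℚ-normal : ∀ k → ℕ→ℚ k ≡ mkℚ (+ k) 0 (coprime-sym (1-coprimeTo k))
  ℕ→ℚ-normal k = normalize-coprime (coprime-sym (1-coprimeTo k))

  ℕ→ℚ-+ : ∀ a b → ℕ→ℚ (a ℕ.+ b) ≡ ℕ→ℚ a + ℕ→ℚ b
  ℕ→ℚ-+ a b rewrite ℕ→ℚ-normal a | ℕ→ℚ-normal b =
    /-cong (trans (ℤ.pos-+ a b) (sym (cong₂ ℤ._+_ (ℤ.*-identityʳ (+ a)) (ℤ.*-identityʳ (+ b))))) refl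

  ℕ→ℚ-* : ∀ a b → ℕ→ℚ (a ℕ.* b) ≡ ℕ→ℚ a * ℕ→ℚ b
  ℕ→ℚ-* a b rewrite ℕ→ℚ-normal a | ℕ→ℚ-normal b = /-cong (ℤ.pos-* a b) refl

  ℕ→ℚ-mono : ∀ {a b} → a ℕ.≤ b → ℕ→ℚ a ≤ ℕ→ℚ b
  ℕ→ℚ-mono {a} {b} a≤b rewrite ℕ→ℚ-normal a | ℕ→ℚ-normal b = *≤* (ℤ.*-monoʳ-≤-nonNeg (+ 1) (ℤ.+≤+ a≤b))

  ℕ→ℚ-nonNeg : ∀ k → NonNegative (ℕ→ℚ k)
  ℕ→ℚ-nonNeg k rewrite ℕ→ℚ-normal k = _

  four two : ℚ
  four = + 4 / 1
  two  = + 2 / 1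

  4c-1-positive : ∀ c → + 1 / 4 < c → Positive (four * c - + 1 / 1)
  4c-1-positive c c>1/4 = positive (begin-strict
      0ℚ                  ≡⟨⟩
      four * (+ 1 / 4) - 1ℚ  <⟨ +-monoˡ-< (- 1ℚ) (*-monoʳ-<-pos four c>1/4) ⟩
      four * c - 1ℚ          ∎)
    where open ≤-Reasoning

  1/[4c-1]-positive : ∀ c → + 1 / 4 < c → (nz : NonZero (four * c - + 1 / 1)) →
    + 0 / 1 < (1/ (four * c - + 1 / 1)) {{nz}}
  1/[4c-1]-positive c c>1/4 nz =
    positive⁻¹ _ {{1/pos⇒pos (four * c - + 1 / 1) {{4c-1-positive c c>1/4}}}}

  w+1≤4cw : ∀ c → + 1 / 4 < c → ∀ w → (nz : NonZero (four * c - + 1 / 1)) →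
    ¬ (ℕ→ℚ w < (1/ (four * c - + 1 / 1)) {{nz}}) → ℕ→ℚ (w ℕ.+ 1) ≤ (four * c) * ℕ→ℚ w
  w+1≤4cw c c>1/4 w nz w≮1/d = begin
      ℕ→ℚ (w ℕ.+ 1)           ≡⟨ trans (ℕ→ℚ-+ w 1) (+-comm ŵ 1ℚ) ⟩
      1ℚ + ŵ                  ≡⟨ cong (_+ ŵ) (*-inverseˡ d {{nz}}) ⟨
      (1/ d) {{nz}} * d + ŵ   ≤⟨ +-monoˡ-≤ ŵ (*-monoʳ-≤-nonNeg d {{pos⇒nonNeg d {{d>0}}}} (≮⇒≥ w≮1/d)) ⟩
      ŵ * d + ŵ               ≡⟨ solve 2 (λ c w → w :* (con four :* c :- con 1ℚ) :+ w := (con four :* c) :* w) refl c ŵ ⟩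
      (four * c) * ŵ          ∎
    where
    open ≤-Reasoning
    open +-*-Solver
    ŵ d : ℚ
    ŵ = ℕ→ℚ w
    d = four * c - + 1 / 1
    d>0 : Positive d
    d>0 = 4c-1-positive c c>1/4

  ℕ→ℚ-count : ∀ X Y m w → 4 ℕ.* X ℕ.≤ 4 ℕ.* Y ℕ.+ 2 ℕ.* m ℕ.* (w ℕ.+ 1) ℕ.+ w ℕ.* (w ℕ.+ 1) →
    four * ℕ→ℚ X ≤ four * ℕ→ℚ Y + (two * ℕ→ℚ m) * ℕ→ℚ (w ℕ.+ 1) + ℕ→ℚ w * ℕ→ℚ (w ℕ.+ 1)
  ℕ→ℚ-count X Y m w bound = begin
      four * ℕ→ℚ X
    ≡⟨ ℕ→ℚ-* 4 X ⟨
      ℕ→ℚ (4 ℕ.* X)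
    ≤⟨ ℕ→ℚ-mono bound ⟩
      ℕ→ℚ (4 ℕ.* Y ℕ.+ 2 ℕ.* m ℕ.* (w ℕ.+ 1) ℕ.+ w ℕ.* (w ℕ.+ 1))
    ≡⟨ trans (ℕ→ℚ-+ (4 ℕ.* Y ℕ.+ 2 ℕ.* m ℕ.* (w ℕ.+ 1)) (w ℕ.* (w ℕ.+ 1)))
         (cong₂ _+_ (trans (ℕ→ℚ-+ (4 ℕ.* Y) (2 ℕ.* m ℕ.* (w ℕ.+ 1))) (cong₂ _+_ (ℕ→ℚ-* 4 Y)
          (trans (ℕ→ℚ-* (2 ℕ.* m) (w ℕ.+ 1)) (cong (_* ℕ→ℚ (w ℕ.+ 1)) (ℕ→ℚ-* 2 m))))) (ℕ→ℚ-* w (w ℕ.+ 1))) ⟩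
      four * ℕ→ℚ Y + (two * ℕ→ℚ m) * ℕ→ℚ (w ℕ.+ 1) + ℕ→ℚ w * ℕ→ℚ (w ℕ.+ 1)
    ∎
    where open ≤-Reasoning

  scale-bound : ∀ c (X Y m w : ℕ) → 4 ℕ.* X ℕ.≤ 4 ℕ.* Y ℕ.+ 2 ℕ.* m ℕ.* (w ℕ.+ 1) ℕ.+ w ℕ.* (w ℕ.+ 1) →
    ℕ→ℚ Y ≤ c * ℕ→ℚ (m ℕ.* m) → ℕ→ℚ (w ℕ.+ 1) ≤ (four * c) * ℕ→ℚ w →
    ℕ→ℚ X ≤ c * ℕ→ℚ ((m ℕ.+ w) ℕ.* (m ℕ.+ w))
  scale-bound c X Y m w bound Y≤cm² w+1≤4cw = *-cancelˡ-≤-pos four (begin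
      four * ℕ→ℚ X
    ≤⟨ ℕ→ℚ-count X Y m w bound ⟩
      four * ℕ→ℚ Y + (two * m̂) * W + ŵ * W
    ≤⟨ +-mono-≤ (+-mono-≤ (*-monoˡ-≤-nonNeg four Y≤cm²)
                          (*-monoˡ-≤-nonNeg (two * m̂) {{nonNeg*nonNeg⇒nonNeg two {{_}} m̂ {{ℕ→ℚ-nonNeg m}}}} w+1≤4cw))
                (*-monoˡ-≤-nonNeg ŵ {{ℕ→ℚ-nonNeg w}} w+1≤4cw) ⟩
      four * (c * ℕ→ℚ (m ℕ.* m)) + (two * m̂) * ((four * c) * ŵ) + ŵ * ((four * c) * ŵ)
    ≡⟨ cong (λ z → four * (c * z) + (two * m̂) * ((four * c) * ŵ) + ŵ * ((four * c) * ŵ)) (ℕ→ℚ-* m m) ⟩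
      four * (c * (m̂ * m̂)) + (two * m̂) * ((four * c) * ŵ) + ŵ * ((four * c) * ŵ)
    ≡⟨ solve 3 (λ c m w → con four :* (c :* (m :* m)) :+ (con two :* m) :* ((con four :* c) :* w) :+ w :* ((con four :* c) :* w)
                        := con four :* (c :* ((m :+ w) :* (m :+ w)))) refl c m̂ ŵ ⟩
      four * (c * ((m̂ + ŵ) * (m̂ + ŵ)))
    ≡⟨ cong (λ z → four * (c * z)) (trans (ℕ→ℚ-* (m ℕ.+ w) (m ℕ.+ w)) (cong₂ _*_ (ℕ→ℚ-+ m w) (ℕ→ℚ-+ m w))) ⟨
      four * (c * ℕ→ℚ ((m ℕ.+ w) ℕ.* (m ℕ.+ w)))
    ∎)
    where
    open ≤-Reasoning
    open +-*-Solver
    m̂ ŵ W : ℚ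
    m̂ = ℕ→ℚ m
    ŵ = ℕ→ℚ w
    W = ℕ→ℚ (w ℕ.+ 1)


open import Data.Rational using (ℚ; _<_; _≤_; _*_; _-_; _/_; 1/_; NonZero)
open import Data.Integer using (+_)
open import Data.Nat as ℕ using (zero; suc; _+_)
open import Data.Nat.Properties using (m<m+n)
open import Data.Rational.Properties using (_≤?_; _<?_)
open import Data.Fin using (Fin)
open import Data.Product using (_,_)
open import Data.Empty using (⊥-elim)
open import Function.Definitions using (Injective)
open import Relation.Binary.PropositionalEquality using (_≡_; subst)
open import Relation.Nullary using (yes; no)
open import Relation.Nullary.Decidable using (decidable-stable)
open Counting using (module CliqueComplement; ¬¬-α₁; ¬¬-τ_B)
open RationalBounds using (1/[4c-1]-positive; w+1≤4cw; scale-bound)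

large-clique-satisfies : ∀ c {n} (G : Graph n) →
  (∀ m (f : Fin m → Fin n) (inj : Injective _≡_ _≡_ f) → m ℕ.< n → Satisfies c (induced G f inj)) →
  ∀ {w} (K : Fin (suc w) → Fin n) → IsClique G K → (∀ k (f : Fin k → Fin n) → IsClique G f → k ℕ.≤ suc w) →
  ℕ→ℚ (suc w + 1) ≤ ((+ 4 / 1) * c) * ℕ→ℚ (suc w) → Satisfies c G
large-clique-satisfies c {n} G subgraphs-satisfy {w} K K-clique K-maximum w+1≤4cw a t αG τG =
  decidable-stable (ℕ→ℚ (a + t) ≤? c * ℕ→ℚ (n ℕ.* n)) λ G-fails →
    ¬¬-α₁ H λ { (A , αH) → ¬¬-τ_B H λ { (τ , τH) → G-fails (
      subst (λ k → ℕ→ℚ (a + t) ≤ c * ℕ→ℚ (k ℕ.* k)) m+w≡n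
        (scale-bound c (a + t) (A + τ) m (suc w) (α+τ-bound αG τG αH τH)
          (subgraphs-satisfy m vertexH (injective H-enumeration) m<n A τ αH τH) w+1≤4cw)) } }
  where
  open CliqueComplement G K K-clique K-maximum
  open Counting using (injective)
  m<n : m ℕ.< n
  m<n = subst (m ℕ.<_) m+w≡n (m<m+n m (ℕ.s≤s ℕ.z≤n))

lemma2p2 : (c : ℚ) → (+ 1 / 4) < c → ∀ {n} (G : Graph n) → MinimalCounterexample c G →
    ∀ (w : ℕ) → IsOmega G w → (nz : NonZero ((+ 4 / 1) * c - (+ 1 / 1))) →
    (+ w / 1) < (1/ ((+ 4 / 1) * c - (+ 1 / 1))) {{nz}}
lemma2p2 c c>1/4 G _ zero _ nz = 1/[4c-1]-positive c c>1/4 nz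
lemma2p2 c c>1/4 G (G-fails , subgraphs-satisfy) (suc w) ((K , K-clique) , K-maximum) nz
  with ℕ→ℚ (suc w) <? (1/ ((+ 4 / 1) * c - (+ 1 / 1))) {{nz}}
... | yes w<1/[4c-1] = w<1/[4c-1]
... | no  w≮1/[4c-1] = ⊥-elim (G-fails (large-clique-satisfies c G subgraphs-satisfy K K-clique K-maximum
                                          (w+1≤4cw c c>1/4 (suc w) nz w≮1/[4c-1])))
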